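{- For every integer $n\ge1$ and every linear order on the vertex set of the Legendre polytope $P_n$, the pulling triangulation of the boundary of $P_n$ with respect to this order is a flag simplicial complex.
   Context: The Legendre polytope $P_n\subset\mathbb{R}^{n+1}$ is the convex hull of all $e_j-e_i$ with $i\ne j$ in $\{1,\ldots,n+1\}$ ($e_1,\ldots,e_{n+1}$ the standard basis); its boundary complex consists of all proper faces of $P_n$. Pulling triangulation (Hudson): for a polytopal complex $\mathcal{P}$ with a linear order $<$ on its vertex set, $\triangle(\mathcal{P})=\mathcal{P}$ if $\mathcal{P}$ is a single vertex; otherwise, with $v$ the least vertex, $\triangle(\mathcal{P})=\triangle(\mathcal{P}-v)\cup\bigcup_F\{\mathrm{conv}(\{v\}\cup G): G\in\triangle(\mathcal{P}(F))\}$, where $\mathcal{P}-v$ is the complex of faces not containing $v$, $\mathcal{P}(F)$ is the complex of faces contained in $F$, the union runs over the facets $F$ not containing $v$ of the maximal faces of $\mathcal{P}$ containing $v$, and the orders are restricted. This is a triangulation of $\mathcal{P}$ with no new vertices. A simplicial complex is flag if every minimal nonface has exactly two elements (equivalently, every set of vertices which are pairwise joined by edges is a face). -}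

module Defs where

open import Level using (0ℓ)
open import Data.Bool using (Bool; T; _∨_; false)
open import Data.Nat using (ℕ; suc)
open import Data.Fin using (Fin; punchIn) renaming (_≟_ to _≟ᶠ_)
open import Data.Integer using (ℤ; _-_; _≤_)
open import Data.Product using (Σ; ∃; _×_; _,_)
open import Data.Product.Properties using (≡-dec)
open import Data.Sum using (_⊎_)
open import Data.Empty using (⊥)
open import Relation.Nullary using (¬_; does)
open import Relation.Binary.Core using (Rel)
open import Relation.Binary.Definitions using (DecidableEquality)
open import Relation.Binary.PropositionalEquality using (_≡_; _≢_)

-- A subset of V is a Boolean-valued function; a face (or simplex) is
-- recorded by its vertex set; a (polytopal / simplicial) complex is a
-- collection of vertex sets (including the empty face).

Sub : Set → Set
Sub V = V → Bool

module Complexes {V : Set} (_≟_ : DecidableEquality V) where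

  infix 4 _∈_ _∉_ _⊆_ _≐_

  _∈_ : V → Sub V → Set
  x ∈ S = T (S x)

  _∉_ : V → Sub V → Set
  x ∉ S = ¬ (x ∈ S)

  _⊆_ : Sub V → Sub V → Set
  S ⊆ S′ = ∀ x → x ∈ S → x ∈ S′

  _≐_ : Sub V → Sub V → Set
  S ≐ S′ = (S ⊆ S′) × (S′ ⊆ S)

  ∅ : Sub V
  ∅ _ = false

  insert : V → Sub V → Sub V
  insert v G x = does (x ≟ v) ∨ G x

  pair : V → V → Sub V
  pair x y = insert x (insert y ∅)

  Complex : Set₁
  Complex = Sub V → Set

  IsVertex : Complex → V → Set
  IsVertex 𝒫 x = ∃ λ F → 𝒫 F × x ∈ F

  AtMostOneVertex : Complex → Set
  AtMostOneVertex 𝒫 = ∀ x y → IsVertex 𝒫 x → IsVertex 𝒫 y → x ≡ y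

  _─_ : Complex → V → Complex
  (𝒫 ─ v) F = 𝒫 F × v ∉ F

  _⟨_⟩ : Complex → Sub V → Complex
  (𝒫 ⟨ F ⟩) H = 𝒫 H × H ⊆ F

  MaximalFace : Complex → Sub V → Set
  MaximalFace 𝒫 M = 𝒫 M × (∀ H → 𝒫 H → M ⊆ H → H ⊆ M)

  -- F is a facet of the face M: a maximal face of 𝒫 properly contained in M
  -- (faces of a face of a polytopal complex are the faces of the complex
  -- contained in it, and the face lattice is graded)
  FacetOf : Complex → Sub V → Sub V → Set
  FacetOf 𝒫 M F =
    𝒫 F × F ⊆ M × (∃ λ x → x ∈ M × x ∉ F) ×
    (∀ H → 𝒫 H → F ⊆ H → H ⊆ M → (∃ λ x → x ∈ M × x ∉ H) → H ⊆ F)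

  module Pulling (_<_ : Rel V 0ℓ) where

    Least : Complex → V → Set
    Least 𝒫 v = IsVertex 𝒫 v × (∀ w → IsVertex 𝒫 w → w ≢ v → v < w)

    -- Pull 𝒫 σ : σ is (the vertex set of) a simplex of the pulling
    -- triangulation △(𝒫) (Hudson's recursive definition).
    data Pull : Complex → Sub V → Set₁ where
      base : ∀ {𝒫 σ} → AtMostOneVertex 𝒫 → 𝒫 σ → Pull 𝒫 σ
      rest : ∀ {𝒫 v σ} → ¬ AtMostOneVertex 𝒫 → Least 𝒫 v →
             Pull (𝒫 ─ v) σ → Pull 𝒫 σ
      -- conv({v} ∪ G), G ∈ △(𝒫(F)), F a facet not containing v of a
      -- maximal face M containing v
      cone : ∀ {𝒫 v M F G} → ¬ AtMostOneVertex 𝒫 → Least 𝒫 v →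
             MaximalFace 𝒫 M → v ∈ M → FacetOf 𝒫 M F → v ∉ F →
             Pull (𝒫 ⟨ F ⟩) G → Pull 𝒫 (insert v G)

    IsSimplex : Complex → Sub V → Set₁
    IsSimplex 𝒫 S = ∃ λ σ → Pull 𝒫 σ × σ ≐ S

    -- flag: every vertex set whose elements are pairwise joined by edges
    -- (pairs x,y with x ≡ y: each element is a vertex) is a face
    IsFlagPulling : Complex → Set₁
    IsFlagPulling 𝒫 =
      ∀ (S : Sub V) → (∀ x y → x ∈ S → y ∈ S → IsSimplex 𝒫 (pair x y)) →
      IsSimplex 𝒫 S

-- The Legendre polytope P_n ⊂ ℝ^{n+1}.
-- Vertex (i , k) stands for e_j - e_i with j = punchIn i k (so j ≠ i);
-- this is a bijection onto the ordered pairs (i , j), i ≠ j.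

LVertex : ℕ → Set
LVertex n = Fin (suc n) × Fin n

_≟ᴸ_ : ∀ {n} → DecidableEquality (LVertex n)
_≟ᴸ_ = ≡-dec _≟ᶠ_ _≟ᶠ_

value : ∀ {n} → (Fin (suc n) → ℤ) → LVertex n → ℤ
value c (i , k) = c (punchIn i k) - c i

ExposedBy : ∀ {n} → (Fin (suc n) → ℤ) → Sub (LVertex n) → Set
ExposedBy {n} c S =
  ∀ x → (T (S x) → ∀ w → value c w ≤ value c x) ×
        ((∀ w → value c w ≤ value c x) → T (S x))

IsFaceLegendre : ∀ n → Sub (LVertex n) → Set
IsFaceLegendre n S = (∀ x → ¬ T (S x)) ⊎ (∃ λ c → ExposedBy {n} c S)

boundaryLegendre : ∀ n → Sub (LVertex n) → Set
boundaryLegendre n S = IsFaceLegendre n S × (∃ λ x → ¬ T (S x))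

{-# OPTIONS --safe #-}
-- Vertex (i , k) of P_n is the arrow from i to j = punchIn i k.  A proper face of P_n is the set
-- of arrows from I to J for disjoint I and J, so every face is closed under corners (with x and
-- y it contains the arrow from the tail of x to the head of y) and no arrow of a face starts
-- where another one ends.  A vertex set S is then a simplex of the pulling triangulation exactly
-- when S lies in a face and no corner of two arrows x, y ∈ S lies below both x and y; both are
-- conditions on pairs, so the triangulation is flag.  Conversely, follow the recursion with the least vertex v:
-- if v ∉ S, then S lies in a face avoiding v; if v ∈ S, then no arrow of S ∖ {v} shares its tail
-- with v or none shares its head (else v would be a low corner), so S ∖ {v} lies in a facet,
-- missing v, of a maximal face containing S.

module Submission where

open import Defs
open import Level using (0ℓ)
open import Data.Bool using (Bool; true; false; T; _∧_; not)
open import Data.Empty using (⊥-elim)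
open import Data.Fin using (Fin; zero; punchIn; punchOut; fromℕ<) renaming (_≟_ to _≟ᶠ_)
open import Data.Fin.Properties using (punchIn-punchOut; punchInᵢ≢i; punchIn-injective; any?; all?)
open import Data.Fin.Subset using (Subset; ⁅_⁆; Nonempty; Empty; _⊃_)
  renaming (_∈_ to _∈ᶠ_; _∉_ to _∉ᶠ_; _⊆_ to _⊆ᶠ_)
open import Data.Fin.Subset.Induction using (⊃-wellFounded)
open import Data.Fin.Subset.Properties using (anySubset?; _⊂?_; p⊂q⇒p⊆q; nonempty?; x∈⁅x⁆; x∈⁅y⁆⇒x≡y)
  renaming (_∈?_ to _∈ᶠ?_)
open import Data.Integer using (ℤ; +_; +≤+; -≤+; _-_; -_; 0ℤ; 1ℤ; -1ℤ) renaming (_≤_ to _≤ᶻ_; _<_ to _<ᶻ_)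
import Data.Integer.Properties as ℤ
open import Data.Integer.Tactic.RingSolver using (solve-∀)
open import Data.List using (List; []; _∷_; filter; length; cartesianProduct; allFin)
open import Data.List.Membership.Propositional using () renaming (_∈_ to _∈ˡ_)
open import Data.List.Membership.Propositional.Properties using (∈-filter⁺; ∈-cartesianProduct⁺; ∈-allFin)
open import Data.List.Properties using (filter-notAll)
open import Data.List.Relation.Unary.Any as Any using (here; there)
open import Data.Nat using (ℕ; suc; z≤n; s≤s; _≤_) renaming (_<_ to _<ℕ_)
open import Data.Nat.Induction using (<-wellFounded)
open import Data.Product using (∃; _×_; _,_; proj₁; proj₂)
open import Data.Sum using (_⊎_; inj₁; inj₂)
open import Data.Vec using (tabulate)
open import Data.Vec.Properties using (lookup⇒[]=; []=⇒lookup; lookup∘tabulate)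
open import Function using (_∘_; id)
open import Induction.WellFounded using (Acc; acc)
open import Relation.Binary.Core using (Rel)
open import Relation.Binary.Definitions using (DecidableEquality; tri<; tri≈; tri>)
open import Relation.Binary.PropositionalEquality
  using (_≡_; _≢_; refl; sym; trans; cong; cong₂; subst; module ≡-Reasoning)
open import Relation.Binary.Structures using (IsStrictTotalOrder)
open import Relation.Nullary using (¬_; Dec; yes; no; does)
open import Relation.Nullary.Decidable using (T?; _×-dec_; _→-dec_; ¬?; map′; dec-true)
open import Relation.Unary using (Pred; Decidable)

module _ {A : Set} {_≺_ : Rel A 0ℓ} (sto : IsStrictTotalOrder _≡_ _≺_)
         {P : Pred A 0ℓ} (P? : Decidable P) where

  open IsStrictTotalOrder sto using (compare; asym; irrefl) renaming (trans to ≺-trans)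

  minimal-in : (xs : List A) →
               (∃ λ m → P m × ∀ {y} → y ∈ˡ xs → P y → ¬ y ≺ m) ⊎ (∀ {y} → y ∈ˡ xs → ¬ P y)
  minimal-in [] = inj₂ λ ()
  minimal-in (x ∷ xs) with P? x | minimal-in xs
  ... | no ¬px | inj₂ none = inj₂ λ { (here refl) → ¬px ; (there y∈) → none y∈ }
  ... | no ¬px | inj₁ (m , pm , min) =
    inj₁ (m , pm , λ { (here refl) py → ⊥-elim (¬px py) ; (there y∈) → min y∈ })
  ... | yes px | inj₂ none =
    inj₁ (x , px , λ { (here refl) _ → irrefl refl ; (there y∈) py → ⊥-elim (none y∈ py) })
  ... | yes px | inj₁ (m , pm , min) with compare x m
  ...   | tri< x≺m _ _ =
    inj₁ (x , px , λ { (here refl) _ → irrefl refl ; (there y∈) py y≺x → min y∈ py (≺-trans y≺x x≺m) })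
  ...   | tri≈ _ refl _ = inj₁ (m , pm , λ { (here refl) _ → irrefl refl ; (there y∈) → min y∈ })
  ...   | tri> _ _ m≺x = inj₁ (m , pm , λ { (here refl) _ x≺m → asym x≺m m≺x ; (there y∈) → min y∈ })

module _ {m : ℕ} {P : Pred (Subset m) 0ℓ} (P? : Decidable P) where

  Maximal : Subset m → Set
  Maximal I = P I × ∀ {K} → P K → I ⊆ᶠ K → K ⊆ᶠ I

  maximal-above : ∀ {I} → P I → ∃ λ I′ → I ⊆ᶠ I′ × Maximal I′
  maximal-above {I} = extend (⊃-wellFounded I)
    where
    extend : ∀ {I} → Acc _⊃_ I → P I → ∃ λ I′ → I ⊆ᶠ I′ × Maximal I′
    extend {I} (acc larger) pI with anySubset? (λ K → P? K ×-dec I ⊂? K)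
    ... | yes (K , pK , I⊂K) with extend (larger I⊂K) pK
    ...   | I′ , K⊆I′ , max = I′ , K⊆I′ ∘ p⊂q⇒p⊆q I⊂K , max
    extend {I} _ pI | no ∄K = I , id , pI , K⊆I
      where
      K⊆I : ∀ {K} → P K → I ⊆ᶠ K → K ⊆ᶠ I
      K⊆I {K} pK I⊆K {x} x∈K with x ∈ᶠ? I
      ... | yes x∈I = x∈I
      ... | no x∉I = ⊥-elim (∄K (K , pK , I⊆K , x , x∈K , x∉I))

module _ {m : ℕ} {P : Pred (Fin m) 0ℓ} (P? : Decidable P) where

  select : Subset m
  select = tabulate (does ∘ P?)

  ∈select⁺ : ∀ {i} → P i → i ∈ᶠ select
  ∈select⁺ {i} p = lookup⇒[]= i select (trans (lookup∘tabulate (does ∘ P?) i) (dec-true (P? i) p))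

  ∈select⁻ : ∀ {i} → i ∈ᶠ select → P i
  ∈select⁻ {i} i∈ with P? i | trans (sym (lookup∘tabulate (does ∘ P?) i)) ([]=⇒lookup i∈)
  ... | yes p | _ = p

module _ {m : ℕ} where

  infixl 5 _∖_

  _∖_ : Subset m → Fin m → Subset m
  p ∖ k = select λ i → i ∈ᶠ? p ×-dec ¬? (i ≟ᶠ k)

  ∈∖⁺ : ∀ {p k x} → x ∈ᶠ p → x ≢ k → x ∈ᶠ p ∖ k
  ∈∖⁺ {p} {k} x∈p x≢k = ∈select⁺ (λ i → i ∈ᶠ? p ×-dec ¬? (i ≟ᶠ k)) (x∈p , x≢k)

  ∈∖⁻ : ∀ p k {x} → x ∈ᶠ p ∖ k → x ∈ᶠ p × x ≢ k
  ∈∖⁻ p k = ∈select⁻ λ i → i ∈ᶠ? p ×-dec ¬? (i ≟ᶠ k)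

  ∖-empty : ∀ {p k x} → Empty (p ∖ k) → x ∈ᶠ p → x ≡ k
  ∖-empty {k = k} {x} empty x∈p with x ≟ᶠ k
  ... | yes x≡k = x≡k
  ... | no x≢k = ⊥-elim (empty (x , ∈∖⁺ x∈p x≢k))

-- Pulling triangulations

module ComplexProperties {V : Set} (_≟_ : DecidableEquality V) where

  open Complexes _≟_

  delete : V → Sub V → Sub V
  delete v S x = not (does (x ≟ v)) ∧ S x

  ∈delete⁺ : ∀ {v} S {x} → x ∈ S → x ≢ v → x ∈ delete v S
  ∈delete⁺ {v} _ {x} x∈S x≢v with x ≟ v
  ... | yes x≡v = ⊥-elim (x≢v x≡v)
  ... | no _ = x∈S

  ∈delete⁻ : ∀ {v} S {x} → x ∈ delete v S → x ∈ S × x ≢ v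
  ∈delete⁻ {v} _ {x} x∈ with x ≟ v
  ... | no x≢v = x∈ , x≢v

  ∈insert⁻ : ∀ {v} G {x} → x ∈ insert v G → x ≡ v ⊎ x ∈ G
  ∈insert⁻ {v} _ {x} x∈ with x ≟ v
  ... | yes x≡v = inj₁ x≡v
  ... | no _ = inj₂ x∈

  ∈insert-self : ∀ {v} G → v ∈ insert v G
  ∈insert-self {v} _ with v ≟ v
  ... | yes _ = _
  ... | no v≢v = ⊥-elim (v≢v refl)

  ∈insert⁺ : ∀ {v} G {x} → x ∈ G → x ∈ insert v G
  ∈insert⁺ {v} _ {x} x∈G with x ≟ v
  ... | yes _ = _
  ... | no _ = x∈G

  insert-delete : ∀ {v S σ} → v ∈ S → σ ≐ delete v S → insert v σ ≐ S
  insert-delete {v} {S} {σ} v∈S (σ⊆ , ⊆σ) = ⊆S , S⊆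
    where
    ⊆S : insert v σ ⊆ S
    ⊆S x x∈ with ∈insert⁻ σ x∈
    ... | inj₁ refl = v∈S
    ... | inj₂ x∈σ = proj₁ (∈delete⁻ S (σ⊆ x x∈σ))
    S⊆ : S ⊆ insert v σ
    S⊆ x x∈S with x ≟ v
    ... | yes _ = _
    ... | no x≢v = ⊆σ x (∈delete⁺ S x∈S x≢v)

  WithinFace : Complex → Sub V → Set
  WithinFace 𝒫 S = ∃ λ M → 𝒫 M × S ⊆ M

  without : V → List V → List V
  without v = filter λ z → ¬? (z ≟ v)

  without-shorter : ∀ {v L} → v ∈ˡ L → length (without v L) <ℕ length L
  without-shorter {v} {L} v∈L = filter-notAll (λ z → ¬? (z ≟ v)) L (Any.map (λ { refl z≢v → z≢v refl }) v∈L)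

  ∈without : ∀ {v z L} → z ∈ˡ L → z ≢ v → z ∈ˡ without v L
  ∈without {v} z∈L z≢v = ∈-filter⁺ (λ z → ¬? (z ≟ v)) z∈L z≢v

  delete⊆without : ∀ {v W L} → (∀ z → z ∈ W → z ∈ˡ L) → ∀ z → z ∈ delete v W → z ∈ˡ without v L
  delete⊆without {W = W} W⊆L z z∈ = let (z∈W , z≢v) = ∈delete⁻ W z∈ in ∈without (W⊆L z z∈W) z≢v

  module PullingProperties {_≺_ : Rel V 0ℓ} (sto : IsStrictTotalOrder _≡_ _≺_) where

    open Pulling _≺_
    open IsStrictTotalOrder sto using (asym; irrefl)

    ¬≺least : ∀ {𝒫 v c} → Least 𝒫 v → IsVertex 𝒫 c → ¬ c ≺ v
    ¬≺least {v = v} {c} (_ , least) c-vertex c≺v with c ≟ v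
    ... | yes refl = irrefl refl c≺v
    ... | no c≢v = asym c≺v (least c c-vertex c≢v)

    pull⇒withinFace : ∀ {𝒫 σ} → Pull 𝒫 σ → WithinFace 𝒫 σ
    pull⇒withinFace {σ = σ} (base _ σ∈𝒫) = σ , σ∈𝒫 , λ _ → id
    pull⇒withinFace (rest _ _ p) with pull⇒withinFace p
    ... | M , (M∈𝒫 , _) , σ⊆M = M , M∈𝒫 , σ⊆M
    pull⇒withinFace (cone {v = v} {M} {G = G} _ _ (M∈𝒫 , _) v∈M (_ , F⊆M , _) _ p) with pull⇒withinFace p
    ... | M′ , (_ , M′⊆F) , G⊆M′ = M , M∈𝒫 , vG⊆M
      where
      vG⊆M : insert v G ⊆ M
      vG⊆M x x∈ with ∈insert⁻ G x∈
      ... | inj₁ refl = v∈M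
      ... | inj₂ x∈G = F⊆M x (M′⊆F x (G⊆M′ x x∈G))

    pair-simplex : ∀ {𝒫 x y} → IsSimplex 𝒫 (pair x y) → ∃ λ σ → Pull 𝒫 σ × x ∈ σ × y ∈ σ
    pair-simplex {x = x} {y} (σ , p , _ , ⊆σ) =
      σ , p , ⊆σ x (∈insert-self (insert y ∅)) , ⊆σ y (∈insert⁺ (insert y ∅) (∈insert-self ∅))

    simplex-rest : ∀ {𝒫 v S} → ¬ AtMostOneVertex 𝒫 → Least 𝒫 v → IsSimplex (𝒫 ─ v) S → IsSimplex 𝒫 S
    simplex-rest many least (σ , p , σ≐S) = σ , rest many least p , σ≐S

    simplex-cone : ∀ {𝒫 v M F S} → ¬ AtMostOneVertex 𝒫 → Least 𝒫 v →
                   MaximalFace 𝒫 M → v ∈ M → FacetOf 𝒫 M F → v ∉ F → v ∈ S →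
                   IsSimplex (𝒫 ⟨ F ⟩) (delete v S) → IsSimplex 𝒫 S
    simplex-cone {v = v} many least max v∈M facet v∉F v∈S (σ , p , σ≐) =
      insert v σ , cone many least max v∈M facet v∉F p , insert-delete v∈S σ≐

-- Faces of the Legendre polytope

module Legendre (n : ℕ) where

  open Complexes (_≟ᴸ_ {n})
  open ComplexProperties (_≟ᴸ_ {n})

  V : Set
  V = LVertex n

  N : Set
  N = Fin (suc n)

  Face : Sub V → Set
  Face = boundaryLegendre n

  tl hd : V → N
  tl = proj₁
  hd (i , k) = punchIn i k

  tl≢hd : ∀ x → tl x ≢ hd x
  tl≢hd (i , k) = punchInᵢ≢i i k ∘ sym

  tl-hd-injective : ∀ {x y} → tl x ≡ tl y → hd x ≡ hd y → x ≡ y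
  tl-hd-injective {i , k} {.i , k′} refl hx≡hy = cong (i ,_) (punchIn-injective i k k′ hx≡hy)

  arrow : (i j : N) → i ≢ j → V
  arrow i j i≢j = i , punchOut i≢j

  hd-arrow : ∀ {i j} (i≢j : i ≢ j) → hd (arrow i j i≢j) ≡ j
  hd-arrow = punchIn-punchOut

  reverse : V → V
  reverse x = arrow (hd x) (tl x) (tl≢hd x ∘ sym)

  allV : List V
  allV = cartesianProduct (allFin (suc n)) (allFin n)

  ∈allV : ∀ x → x ∈ˡ allV
  ∈allV (i , k) = ∈-cartesianProduct⁺ (∈-allFin i) (∈-allFin k)

  any-vertex? : {P : V → Set} → (∀ x → Dec (P x)) → Dec (∃ P)
  any-vertex? P? = map′ (λ (i , k , p) → (i , k) , p) (λ ((i , k) , p) → i , k , p)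
                        (any? λ i → any? λ k → P? (i , k))

  all-vertices? : {P : V → Set} → (∀ x → Dec (P x)) → Dec (∀ x → P x)
  all-vertices? P? = map′ (λ f (i , k) → f i k) (λ f i k → f (i , k)) (all? λ i → all? λ k → P? (i , k))

  module ExposedFace (c : N → ℤ) {G : Sub V} (exposed : ExposedBy c G) {u : V} (u∉G : u ∉ G) where

    δ : N → N → ℤ
    δ i j = c j - c i

    δ-cancelˡ : ∀ i j k → δ i k - δ i j ≡ δ j k
    δ-cancelˡ i j k = lemma (c i) (c j) (c k)
      where
      lemma : ∀ a b d → (d - a) - (b - a) ≡ d - b
      lemma = solve-∀

    δ-cancelʳ : ∀ i j k → δ i k - δ j k ≡ δ i j
    δ-cancelʳ i j k = lemma (c i) (c j) (c k)
      where
      lemma : ∀ a b d → (d - a) - (d - b) ≡ b - a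
      lemma = solve-∀

    δ-antisym : ∀ i j → - δ i j ≡ δ j i
    δ-antisym i j = lemma (c i) (c j)
      where
      lemma : ∀ a b → - (b - a) ≡ a - b
      lemma = solve-∀

    δ-refl : ∀ i → δ i i ≡ 0ℤ
    δ-refl i = ℤ.i≡j⇒i-j≡0 {c i} refl

    maximum : ∀ {x} → x ∈ G → ∀ w → value c w ≤ᶻ value c x
    maximum {x} = proj₁ (exposed x)

    attained : ∀ {x} → (∀ w → value c w ≤ᶻ value c x) → x ∈ G
    attained {x} = proj₂ (exposed x)

    δ≤-arrow : ∀ {x i j} → x ∈ G → i ≢ j → δ i j ≤ᶻ value c x
    δ≤-arrow {x} {i} {j} x∈G i≢j =
      subst (_≤ᶻ value c x) (cong (λ k → c k - c i) (hd-arrow i≢j)) (maximum x∈G (arrow i j i≢j))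

    -- If the maximum were at most 0, the reverse of u would show that u attains it.
    value-positive : ∀ {x} → x ∈ G → 0ℤ <ᶻ value c x
    value-positive {x} x∈G with value c x ℤ.≤? 0ℤ
    ... | no x≰0 = ℤ.≰⇒> x≰0
    ... | yes x≤0 = ⊥-elim (u∉G (attained λ w → ℤ.≤-trans (maximum x∈G w) (ℤ.≤-trans x≤0 0≤u)))
      where
      0≤u : 0ℤ ≤ᶻ value c u
      0≤u = subst (0ℤ ≤ᶻ_) (δ-antisym (hd u) (tl u))
                  (ℤ.neg-mono-≤ (ℤ.≤-trans (δ≤-arrow x∈G (tl≢hd u ∘ sym)) x≤0))

    δ≤ : ∀ {x} → x ∈ G → ∀ i j → δ i j ≤ᶻ value c x
    δ≤ x∈G i j with i ≟ᶠ j
    ... | yes refl = subst (_≤ᶻ _) (sym (δ-refl i)) (ℤ.<⇒≤ (value-positive x∈G))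
    ... | no i≢j = δ≤-arrow x∈G i≢j

    bipartite : ∀ {x y} → x ∈ G → y ∈ G → tl x ≢ hd y
    bipartite {x} {y} x∈G y∈G tx≡hy = ℤ.<⇒≱ (value-positive y∈G) y≤0
      where
      y≤0 : value c y ≤ᶻ 0ℤ
      y≤0 = subst (_≤ᶻ 0ℤ) (trans (δ-cancelʳ (tl y) (tl x) (hd x)) (cong (δ (tl y)) tx≡hy))
                  (ℤ.i≤j⇒i-j≤0 (δ≤ x∈G (tl y) (hd x)))

    corner : ∀ {x y z} → x ∈ G → y ∈ G → tl z ≡ tl x → hd z ≡ hd y → z ∈ G
    corner {x} {y} {z} x∈G y∈G tz≡tx hz≡hy = attained λ w → ℤ.≤-trans (maximum x∈G w) x≤z
      where
      open ≡-Reasoning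
      gain : value c y - δ (tl y) (hd x) ≡ value c z - value c x
      gain = begin
        δ (tl y) (hd y) - δ (tl y) (hd x)  ≡⟨ δ-cancelˡ (tl y) (hd x) (hd y) ⟩
        δ (hd x) (hd y)                    ≡⟨ sym (δ-cancelˡ (tl x) (hd x) (hd y)) ⟩
        δ (tl x) (hd y) - δ (tl x) (hd x)  ≡⟨ cong₂ (λ i j → δ i j - value c x) (sym tz≡tx) (sym hz≡hy) ⟩
        value c z - value c x              ∎
      x≤z : value c x ≤ᶻ value c z
      x≤z = ℤ.0≤i-j⇒j≤i (subst (0ℤ ≤ᶻ_) gain (ℤ.i≤j⇒0≤j-i (δ≤ y∈G (tl y) (hd x))))

  Bipartite : Sub V → Set
  Bipartite S = ∀ x y → x ∈ S → y ∈ S → tl x ≢ hd y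

  CornerClosed : Sub V → Set
  CornerClosed S = ∀ x y z → x ∈ S → y ∈ S → tl z ≡ tl x → hd z ≡ hd y → z ∈ S

  face-bipartite : ∀ {G} → Face G → Bipartite G
  face-bipartite (inj₁ empty , _) x _ x∈G = ⊥-elim (empty x x∈G)
  face-bipartite (inj₂ (c , exposed) , _ , u∉G) _ _ = ExposedFace.bipartite c exposed u∉G

  face-cornerClosed : ∀ {G} → Face G → CornerClosed G
  face-cornerClosed (inj₁ empty , _) x _ _ x∈G = ⊥-elim (empty x x∈G)
  face-cornerClosed (inj₂ (c , exposed) , _ , u∉G) _ _ _ = ExposedFace.corner c exposed u∉G

  Disjoint : Subset (suc n) → Subset (suc n) → Set
  Disjoint I J = ∀ {k} → k ∈ᶠ I → k ∉ᶠ J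

  disjoint? : ∀ I J → Dec (Disjoint I J)
  disjoint? I J = map′ (λ f {k} → f k) (λ f k → f) (all? λ k → k ∈ᶠ? I →-dec ¬? (k ∈ᶠ? J))

  prod : Subset (suc n) → Subset (suc n) → Sub V
  prod I J x = does (tl x ∈ᶠ? I) ∧ does (hd x ∈ᶠ? J)

  ∈prod⁺ : ∀ {I J x} → tl x ∈ᶠ I → hd x ∈ᶠ J → x ∈ prod I J
  ∈prod⁺ {I} {J} {x} tx∈I hx∈J with tl x ∈ᶠ? I | hd x ∈ᶠ? J
  ... | yes _ | yes _ = _
  ... | no tx∉I | _ = tx∉I tx∈I
  ... | yes _ | no hx∉J = hx∉J hx∈J

  ∈prod⁻ : ∀ {I J x} → x ∈ prod I J → tl x ∈ᶠ I × hd x ∈ᶠ J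
  ∈prod⁻ {I} {J} {x} x∈ with tl x ∈ᶠ? I | hd x ∈ᶠ? J
  ... | yes tx∈I | yes hx∈J = tx∈I , hx∈J

  prod-mono : ∀ {I I′ J J′} → I ⊆ᶠ I′ → J ⊆ᶠ J′ → prod I J ⊆ prod I′ J′
  prod-mono {I} {J = J} I⊆I′ J⊆J′ x x∈ =
    let (tx∈I , hx∈J) = ∈prod⁻ {I} {J} {x} x∈ in ∈prod⁺ {x = x} (I⊆I′ tx∈I) (J⊆J′ hx∈J)

  arrow∈prod : ∀ {I J i j} → Disjoint I J → i ∈ᶠ I → j ∈ᶠ J →
               ∃ λ x → x ∈ prod I J × tl x ≡ i × hd x ≡ j
  arrow∈prod disj i∈I j∈J =
    arrow _ _ i≢j , ∈prod⁺ {x = arrow _ _ i≢j} i∈I (subst (_∈ᶠ _) (sym (hd-arrow i≢j)) j∈J)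
                  , refl , hd-arrow i≢j
    where
    i≢j : _ ≢ _
    i≢j refl = disj i∈I j∈J

  -- The functional -1 on I, 1 on J and 0 elsewhere takes its maximum 2 exactly on prod I J.
  level : Bool → Bool → ℤ
  level true  _     = -1ℤ
  level false true  = 1ℤ
  level false false = 0ℤ

  level≤1 : ∀ a b → level a b ≤ᶻ 1ℤ
  level≤1 true  _     = -≤+
  level≤1 false true  = ℤ.≤-refl
  level≤1 false false = +≤+ z≤n

  -1≤level : ∀ a b → -1ℤ ≤ᶻ level a b
  -1≤level true  _     = ℤ.≤-refl
  -1≤level false true  = -≤+
  -1≤level false false = -≤+

  level-gap≤2 : ∀ a b a′ b′ → level a b - level a′ b′ ≤ᶻ + 2
  level-gap≤2 a b a′ b′ = ℤ.+-mono-≤ (level≤1 a b) (ℤ.neg-mono-≤ (-1≤level a′ b′))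

  level-gap≥2 : ∀ a b a′ b′ → + 2 ≤ᶻ level a b - level a′ b′ → T (a′ ∧ b)
  level-gap≥2 false true  true  _     _ = _
  level-gap≥2 true  _     true  _     (+≤+ ())
  level-gap≥2 true  _     false true  ()
  level-gap≥2 true  _     false false ()
  level-gap≥2 false true  false true  (+≤+ ())
  level-gap≥2 false true  false false (+≤+ (s≤s ()))
  level-gap≥2 false false true  _     (+≤+ (s≤s ()))
  level-gap≥2 false false false true  ()
  level-gap≥2 false false false false (+≤+ ())

  height : Subset (suc n) → Subset (suc n) → N → ℤ
  height I J k = level (does (k ∈ᶠ? I)) (does (k ∈ᶠ? J))

  height-tail : ∀ {I J k} → k ∈ᶠ I → height I J k ≡ -1ℤ
  height-tail {I} {k = k} k∈I with k ∈ᶠ? I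
  ... | yes _ = refl
  ... | no k∉I = ⊥-elim (k∉I k∈I)

  height-head : ∀ {I J k} → k ∉ᶠ I → k ∈ᶠ J → height I J k ≡ 1ℤ
  height-head {I} {J} {k} k∉I k∈J with k ∈ᶠ? I | k ∈ᶠ? J
  ... | no _ | yes _ = refl
  ... | yes k∈I | _ = ⊥-elim (k∉I k∈I)
  ... | no _ | no k∉J = ⊥-elim (k∉J k∈J)

  height-on-prod : ∀ {I J x} → Disjoint I J → x ∈ prod I J → value (height I J) x ≡ + 2
  height-on-prod {I} {J} {x} disj x∈ =
    cong₂ _-_ (height-head (λ hx∈I → disj hx∈I hx∈J) hx∈J) (height-tail tx∈I)
    where
    tx∈I = proj₁ (∈prod⁻ {I} {J} {x} x∈)
    hx∈J = proj₂ (∈prod⁻ {I} {J} {x} x∈)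

  height≤2 : ∀ I J x → value (height I J) x ≤ᶻ + 2
  height≤2 I J x = level-gap≤2 (does (hd x ∈ᶠ? I)) (does (hd x ∈ᶠ? J)) (does (tl x ∈ᶠ? I)) (does (tl x ∈ᶠ? J))

  height≥2⇒∈prod : ∀ I J x → + 2 ≤ᶻ value (height I J) x → x ∈ prod I J
  height≥2⇒∈prod I J x =
    level-gap≥2 (does (hd x ∈ᶠ? I)) (does (hd x ∈ᶠ? J)) (does (tl x ∈ᶠ? I)) (does (tl x ∈ᶠ? J))

  has-tail? : (S : Sub V) (i : N) → Dec (∃ λ z → z ∈ S × tl z ≡ i)
  has-tail? S i = any-vertex? λ z → T? (S z) ×-dec (tl z ≟ᶠ i)

  has-head? : (S : Sub V) (j : N) → Dec (∃ λ z → z ∈ S × hd z ≡ j)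
  has-head? S j = any-vertex? λ z → T? (S z) ×-dec (hd z ≟ᶠ j)

  tails heads : Sub V → Subset (suc n)
  tails S = select (has-tail? S)
  heads S = select (has-head? S)

  span : Sub V → Sub V
  span S = prod (tails S) (heads S)

  ⊆span : ∀ S → S ⊆ span S
  ⊆span S x x∈S =
    ∈prod⁺ {x = x} (∈select⁺ (has-tail? S) (x , x∈S , refl)) (∈select⁺ (has-head? S) (x , x∈S , refl))

  span-⊆ : ∀ {S G} → Face G → S ⊆ G → span S ⊆ G
  span-⊆ {S} G-face S⊆G x x∈
    with ∈select⁻ (has-tail? S) (proj₁ (∈prod⁻ {x = x} x∈))
       | ∈select⁻ (has-head? S) (proj₂ (∈prod⁻ {x = x} x∈))
  ... | y , y∈S , ty≡tx | z , z∈S , hz≡hx =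
    face-cornerClosed G-face y z x (S⊆G y y∈S) (S⊆G z z∈S) (sym ty≡tx) (sym hz≡hx)

  span-disjoint : ∀ {S} → Bipartite S → Disjoint (tails S) (heads S)
  span-disjoint {S} bip k∈tails k∈heads with ∈select⁻ (has-tail? S) k∈tails | ∈select⁻ (has-head? S) k∈heads
  ... | x , x∈S , tx≡k | y , y∈S , hy≡k = bip x y x∈S y∈S (trans tx≡k (sym hy≡k))

  ⊆tails : ∀ {I J H j} → Disjoint I J → j ∈ᶠ J → prod I J ⊆ H → I ⊆ᶠ tails H
  ⊆tails {H = H} disj j∈J M⊆H i∈I with arrow∈prod disj i∈I j∈J
  ... | x , x∈M , tx≡i , _ = ∈select⁺ (has-tail? H) (x , M⊆H x x∈M , tx≡i)

  ⊆heads : ∀ {I J H i} → Disjoint I J → i ∈ᶠ I → prod I J ⊆ H → J ⊆ᶠ heads H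
  ⊆heads {H = H} disj i∈I M⊆H j∈J with arrow∈prod disj i∈I j∈J
  ... | x , x∈M , _ , hx≡j = ∈select⁺ (has-head? H) (x , M⊆H x x∈M , hx≡j)

  -- A proper face needs a vertex outside it; for n = 0 there are no vertices at all.
  module _ (n≥1 : 1 ≤ n) where

    some-vertex : V
    some-vertex = zero , fromℕ< n≥1

    ∅-face : Face ∅
    ∅-face = inj₁ (λ _ ()) , some-vertex , λ ()

    prod-isFace : ∀ {I J} → Disjoint I J → Face (prod I J)
    prod-isFace {I} {J} disj = face , outside
      where
      face : IsFaceLegendre n (prod I J)
      face with nonempty? I | nonempty? J
      ... | yes (_ , i∈I) | yes (_ , j∈J) = inj₂ (height I J , exposed)
        where
        2≤height : ∀ x → x ∈ prod I J → + 2 ≤ᶻ value (height I J) x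
        2≤height x x∈ = ℤ.≤-reflexive (sym (height-on-prod {x = x} disj x∈))
        exposed : ExposedBy (height I J) (prod I J)
        exposed x = (λ x∈ w → ℤ.≤-trans (height≤2 I J w) (2≤height x x∈))
                  , λ max → let (w , w∈ , _) = arrow∈prod disj i∈I j∈J in
                            height≥2⇒∈prod I J x (ℤ.≤-trans (2≤height w w∈) (max w))
      ... | no ∄i | _ = inj₁ λ x x∈ → ∄i (tl x , proj₁ (∈prod⁻ {I} {J} {x} x∈))
      ... | _ | no ∄j = inj₁ λ x x∈ → ∄j (hd x , proj₂ (∈prod⁻ {I} {J} {x} x∈))
      outside : ∃ λ x → x ∉ prod I J
      outside with T? (prod I J some-vertex)
      ... | no x∉ = some-vertex , x∉
      ... | yes x∈ = reverse some-vertex , λ r∈ →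
        disj (proj₁ (∈prod⁻ {I} {J} {reverse some-vertex} r∈)) (proj₂ (∈prod⁻ {I} {J} {some-vertex} x∈))

    span-face : ∀ {S} → Bipartite S → Face (span S)
    span-face bip = prod-isFace (span-disjoint bip)

    singleton-face : ∀ z → Face (prod ⁅ tl z ⁆ ⁅ hd z ⁆)
    singleton-face z = prod-isFace λ k∈t k∈h → tl≢hd z (trans (sym (x∈⁅y⁆⇒x≡y _ k∈t)) (x∈⁅y⁆⇒x≡y _ k∈h))

    ∈singleton : ∀ z → z ∈ prod ⁅ tl z ⁆ ⁅ hd z ⁆
    ∈singleton z = ∈prod⁺ {x = z} (x∈⁅x⁆ (tl z)) (x∈⁅x⁆ (hd z))

    ∈singleton⁻ : ∀ z x → x ∈ prod ⁅ tl z ⁆ ⁅ hd z ⁆ → x ≡ z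
    ∈singleton⁻ z x x∈ = let (tx∈ , hx∈) = ∈prod⁻ {x = x} x∈ in
      tl-hd-injective (x∈⁅y⁆⇒x≡y (tl z) tx∈) (x∈⁅y⁆⇒x≡y (hd z) hx∈)

    -- Complexes of boundary faces with prescribed vertices

    -- Every complex met in the recursion defining △(∂P_n) is of this form.
    record Models (𝒫 : Complex) (W : Sub V) : Set where
      field
        isFace  : ∀ {G} → 𝒫 G → Face G
        allowed : ∀ {G} → 𝒫 G → G ⊆ W
        face    : ∀ {G} → Face G → G ⊆ W → 𝒫 G

      subface : ∀ {G H} → 𝒫 G → Face H → H ⊆ G → 𝒫 H
      subface G∈𝒫 H-face H⊆G = face H-face λ x x∈H → allowed G∈𝒫 x (H⊆G x x∈H)

      vertex⇒allowed : ∀ {z} → IsVertex 𝒫 z → z ∈ W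
      vertex⇒allowed {z} (G , G∈𝒫 , z∈G) = allowed G∈𝒫 z z∈G

      allowed⇒vertex : ∀ {z} → z ∈ W → IsVertex 𝒫 z
      allowed⇒vertex {z} z∈W = _ , face (singleton-face z) singleton⊆W , ∈singleton z
        where
        singleton⊆W : prod ⁅ tl z ⁆ ⁅ hd z ⁆ ⊆ W
        singleton⊆W x x∈ = subst (_∈ W) (sym (∈singleton⁻ z x x∈)) z∈W

      within-bipartite : ∀ {S} → WithinFace 𝒫 S → Bipartite S
      within-bipartite (M , M∈𝒫 , S⊆M) x y x∈S y∈S = face-bipartite (isFace M∈𝒫) x y (S⊆M x x∈S) (S⊆M y y∈S)

      span∈ : ∀ {S} → WithinFace 𝒫 S → 𝒫 (span S)
      span∈ S-within@(M , M∈𝒫 , S⊆M) =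
        subface M∈𝒫 (span-face (within-bipartite S-within)) (span-⊆ (isFace M∈𝒫) S⊆M)

    open Models

    models-boundary : Models Face (λ _ → true)
    models-boundary = record { isFace = id ; allowed = λ _ _ _ → _ ; face = λ G-face _ → G-face }

    models-─ : ∀ {𝒫 W v} → Models 𝒫 W → Models (𝒫 ─ v) (delete v W)
    models-─ {W = W} {v} 𝒫≈W = record
      { isFace  = isFace 𝒫≈W ∘ proj₁
      ; allowed = λ { (G∈𝒫 , v∉G) x x∈G → ∈delete⁺ W (allowed 𝒫≈W G∈𝒫 x x∈G) λ { refl → v∉G x∈G } }
      ; face    = λ G-face G⊆W′ → face 𝒫≈W G-face (λ x x∈G → proj₁ (∈delete⁻ W (G⊆W′ x x∈G)))
                                , λ v∈G → proj₂ (∈delete⁻ W (G⊆W′ v v∈G)) refl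
      }

    models-⟨⟩ : ∀ {𝒫 W F} → Models 𝒫 W → 𝒫 F → Models (𝒫 ⟨ F ⟩) F
    models-⟨⟩ 𝒫≈W F∈𝒫 = record
      { isFace  = isFace 𝒫≈W ∘ proj₁
      ; allowed = proj₂
      ; face    = λ G-face G⊆F → subface 𝒫≈W F∈𝒫 G-face G⊆F , G⊆F
      }

    Admissible : Sub V → Subset (suc n) → Subset (suc n) → Set
    Admissible W I J = Disjoint I J × prod I J ⊆ W

    admissible? : ∀ W I J → Dec (Admissible W I J)
    admissible? W I J = disjoint? I J ×-dec all-vertices? λ x → T? (prod I J x) →-dec T? (W x)

    admissible-anti : ∀ {W I I′ J J′} → I ⊆ᶠ I′ → J ⊆ᶠ J′ → Admissible W I′ J′ → Admissible W I J
    admissible-anti I⊆I′ J⊆J′ (disj′ , ⊆W) = (λ k∈I k∈J → disj′ (I⊆I′ k∈I) (J⊆J′ k∈J))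
                                           , λ x x∈ → ⊆W x (prod-mono I⊆I′ J⊆J′ x x∈)

    span-admissible : ∀ {𝒫 W S} → Models 𝒫 W → WithinFace 𝒫 S → Admissible W (tails S) (heads S)
    span-admissible 𝒫≈W S-within = span-disjoint (within-bipartite 𝒫≈W S-within) , allowed 𝒫≈W (span∈ 𝒫≈W S-within)

    -- Maximize I with J fixed, then J with I fixed; since admissibility is antitone in both
    -- arguments, the resulting face is maximal.
    maximal-face : ∀ {𝒫 W I J v} → Models 𝒫 W → Admissible W I J → v ∈ prod I J →
                   ∃ λ I′ → ∃ λ J′ → Disjoint I′ J′ × prod I J ⊆ prod I′ J′ × MaximalFace 𝒫 (prod I′ J′)
    maximal-face {𝒫} {W} {J = J} {v} 𝒫≈W adm v∈M with maximal-above (λ K → admissible? W K J) adm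
    ... | I′ , I⊆I′ , adm′ , max-I′ with maximal-above (λ K → admissible? W I′ K) adm′
    ... | J′ , J⊆J′ , (disj′ , M′⊆W) , max-J′ =
      I′ , J′ , disj′ , prod-mono I⊆I′ J⊆J′ , face 𝒫≈W (prod-isFace disj′) M′⊆W , maximal
      where
      maximal : ∀ H → 𝒫 H → prod I′ J′ ⊆ H → H ⊆ prod I′ J′
      maximal H H∈𝒫 M′⊆H x x∈H = prod-mono tails⊆I′ heads⊆J′ x (⊆span H x x∈H)
        where
        I′⊆tails = ⊆tails disj′ (J⊆J′ (proj₂ (∈prod⁻ {x = v} v∈M))) M′⊆H
        J′⊆heads = ⊆heads disj′ (I⊆I′ (proj₁ (∈prod⁻ {x = v} v∈M))) M′⊆H
        adm-H = span-admissible 𝒫≈W (H , H∈𝒫 , λ _ → id)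
        tails⊆I′ = max-I′ (admissible-anti id (J′⊆heads ∘ J⊆J′) adm-H) I′⊆tails
        heads⊆J′ = max-J′ (admissible-anti I′⊆tails id adm-H) J′⊆heads

    RowFree ColumnFree : V → Sub V → Set
    RowFree v S = ∀ x → x ∈ S → x ≢ v → tl x ≢ tl v
    ColumnFree v S = ∀ x → x ∈ S → x ≢ v → hd x ≢ hd v

    AvoidingFacet : Complex → Sub V → V → Sub V → Set
    AvoidingFacet 𝒫 M v S = ∃ λ F → FacetOf 𝒫 M F × v ∉ F × delete v S ⊆ F

    module Facets {𝒫 W} (𝒫≈W : Models 𝒫 W) {I J} (disj : Disjoint I J) (M∈𝒫 : 𝒫 (prod I J))
                  {v} (v∈M : v ∈ prod I J) where

      M : Sub V
      M = prod I J

      v∉row : v ∉ prod (I ∖ tl v) J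
      v∉row v∈F = proj₂ (∈∖⁻ I (tl v) (proj₁ (∈prod⁻ {x = v} v∈F))) refl

      v∉column : v ∉ prod I (J ∖ hd v)
      v∉column v∈F = proj₂ (∈∖⁻ J (hd v) (proj₂ (∈prod⁻ {x = v} v∈F))) refl

      facet-row : Nonempty (I ∖ tl v) → FacetOf 𝒫 M (prod (I ∖ tl v) J)
      facet-row (_ , i∈I⁻) = subface 𝒫≈W M∈𝒫 (prod-isFace disj⁻) F⊆M , F⊆M , (v , v∈M , v∉row) , maximal
        where
        F = prod (I ∖ tl v) J
        disj⁻ : Disjoint (I ∖ tl v) J
        disj⁻ = disj ∘ proj₁ ∘ ∈∖⁻ I (tl v)
        F⊆M : F ⊆ M
        F⊆M = prod-mono (proj₁ ∘ ∈∖⁻ I (tl v)) id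
        maximal : ∀ H → 𝒫 H → F ⊆ H → H ⊆ M → (∃ λ x → x ∈ M × x ∉ H) → H ⊆ F
        maximal H H∈𝒫 F⊆H H⊆M (x , x∈M , x∉H) z z∈H = ∈prod⁺ {x = z} (∈∖⁺ tz∈I tz≢tv) hz∈J
          where
          tz∈I = proj₁ (∈prod⁻ {x = z} (H⊆M z z∈H))
          hz∈J = proj₂ (∈prod⁻ {x = z} (H⊆M z z∈H))
          tx∈I = proj₁ (∈prod⁻ {x = x} x∈M)
          hx∈J = proj₂ (∈prod⁻ {x = x} x∈M)
          tz≢tv : tl z ≢ tl v
          tz≢tv tz≡tv with tl x ≟ᶠ tl v | arrow∈prod disj⁻ i∈I⁻ hx∈J
          ... | no tx≢tv | _ = x∉H (F⊆H x (∈prod⁺ {x = x} (∈∖⁺ tx∈I tx≢tv) hx∈J))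
          ... | yes tx≡tv | w , w∈F , _ , hw≡hx =
            x∉H (face-cornerClosed (isFace 𝒫≈W H∈𝒫) z w x z∈H (F⊆H w w∈F) (trans tx≡tv (sym tz≡tv)) (sym hw≡hx))

      facet-column : Nonempty (J ∖ hd v) → FacetOf 𝒫 M (prod I (J ∖ hd v))
      facet-column (_ , j∈J⁻) = subface 𝒫≈W M∈𝒫 (prod-isFace disj⁻) F⊆M , F⊆M , (v , v∈M , v∉column) , maximal
        where
        F = prod I (J ∖ hd v)
        disj⁻ : Disjoint I (J ∖ hd v)
        disj⁻ k∈I = disj k∈I ∘ proj₁ ∘ ∈∖⁻ J (hd v)
        F⊆M : F ⊆ M
        F⊆M = prod-mono id (proj₁ ∘ ∈∖⁻ J (hd v))
        maximal : ∀ H → 𝒫 H → F ⊆ H → H ⊆ M → (∃ λ x → x ∈ M × x ∉ H) → H ⊆ F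
        maximal H H∈𝒫 F⊆H H⊆M (x , x∈M , x∉H) z z∈H = ∈prod⁺ {x = z} tz∈I (∈∖⁺ hz∈J hz≢hv)
          where
          tz∈I = proj₁ (∈prod⁻ {x = z} (H⊆M z z∈H))
          hz∈J = proj₂ (∈prod⁻ {x = z} (H⊆M z z∈H))
          tx∈I = proj₁ (∈prod⁻ {x = x} x∈M)
          hx∈J = proj₂ (∈prod⁻ {x = x} x∈M)
          hz≢hv : hd z ≢ hd v
          hz≢hv hz≡hv with hd x ≟ᶠ hd v | arrow∈prod disj⁻ tx∈I j∈J⁻
          ... | no hx≢hv | _ = x∉H (F⊆H x (∈prod⁺ {x = x} tx∈I (∈∖⁺ hx∈J hx≢hv)))
          ... | yes hx≡hv | w , w∈F , tw≡tx , _ =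
            x∉H (face-cornerClosed (isFace 𝒫≈W H∈𝒫) w z x (F⊆H w w∈F) z∈H (sym tw≡tx) (trans hx≡hv (sym hz≡hv)))

      single-vertex : Empty (I ∖ tl v) → Empty (J ∖ hd v) → ∀ x → x ∈ M → x ≡ v
      single-vertex only-tv only-hv x x∈M =
        tl-hd-injective (∖-empty only-tv (proj₁ (∈prod⁻ {x = x} x∈M)))
                        (∖-empty only-hv (proj₂ (∈prod⁻ {x = x} x∈M)))

      facet-∅ : Empty (I ∖ tl v) → Empty (J ∖ hd v) → FacetOf 𝒫 M ∅
      facet-∅ only-tv only-hv = subface 𝒫≈W M∈𝒫 ∅-face (λ _ ()) , (λ _ ()) , (v , v∈M , λ ()) , maximal
        where
        maximal : ∀ H → 𝒫 H → ∅ ⊆ H → H ⊆ M → (∃ λ x → x ∈ M × x ∉ H) → H ⊆ ∅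
        maximal H _ _ H⊆M (x , x∈M , x∉H) z z∈H = x∉H (subst (_∈ H) z≡x z∈H)
          where
          z≡x = trans (single-vertex only-tv only-hv z (H⊆M z z∈H))
                      (sym (single-vertex only-tv only-hv x x∈M))

      module _ {S} (S⊆M : S ⊆ M) where

        row-facet : Nonempty (I ∖ tl v) → RowFree v S → AvoidingFacet 𝒫 M v S
        row-facet other rowFree = prod (I ∖ tl v) J , facet-row other , v∉row , S⁻⊆F
          where
          S⁻⊆F : delete v S ⊆ prod (I ∖ tl v) J
          S⁻⊆F x x∈ with ∈delete⁻ S x∈
          ... | x∈S , x≢v = let (tx∈I , hx∈J) = ∈prod⁻ {x = x} (S⊆M x x∈S) in
            ∈prod⁺ {x = x} (∈∖⁺ tx∈I (rowFree x x∈S x≢v)) hx∈J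

        column-facet : Nonempty (J ∖ hd v) → ColumnFree v S → AvoidingFacet 𝒫 M v S
        column-facet other columnFree = prod I (J ∖ hd v) , facet-column other , v∉column , S⁻⊆F
          where
          S⁻⊆F : delete v S ⊆ prod I (J ∖ hd v)
          S⁻⊆F x x∈ with ∈delete⁻ S x∈
          ... | x∈S , x≢v = let (tx∈I , hx∈J) = ∈prod⁻ {x = x} (S⊆M x x∈S) in
            ∈prod⁺ {x = x} tx∈I (∈∖⁺ hx∈J (columnFree x x∈S x≢v))

        single-column : Empty (J ∖ hd v) → ColumnFree v S → RowFree v S
        single-column only-hv columnFree x x∈S x≢v _ =
          columnFree x x∈S x≢v (∖-empty only-hv (proj₂ (∈prod⁻ {x = x} (S⊆M x x∈S))))

        single-row : Empty (I ∖ tl v) → RowFree v S → ColumnFree v S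
        single-row only-tv rowFree x x∈S x≢v _ =
          rowFree x x∈S x≢v (∖-empty only-tv (proj₁ (∈prod⁻ {x = x} (S⊆M x x∈S))))

        avoiding-facet : RowFree v S ⊎ ColumnFree v S → AvoidingFacet 𝒫 M v S
        avoiding-facet free with nonempty? (I ∖ tl v) | nonempty? (J ∖ hd v) | free
        ... | yes other-i | _           | inj₁ rowFree    = row-facet other-i rowFree
        ... | yes other-i | no only-hv  | inj₂ columnFree = row-facet other-i (single-column only-hv columnFree)
        ... | _           | yes other-j | inj₂ columnFree = column-facet other-j columnFree
        ... | no only-tv  | yes other-j | inj₁ rowFree    = column-facet other-j (single-row only-tv rowFree)
        ... | no only-tv  | no only-hv  | _ = ∅ , facet-∅ only-tv only-hv , (λ ()) , S⁻⊆∅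
          where
          S⁻⊆∅ : delete v S ⊆ ∅
          S⁻⊆∅ x x∈ with ∈delete⁻ S x∈
          ... | x∈S , x≢v = x≢v (single-vertex only-tv only-hv x (S⊆M x x∈S))

    -- Simplices of the pulling triangulation

    module Pulled {_≺_ : Rel V 0ℓ} (sto : IsStrictTotalOrder _≡_ _≺_) where

      open Pulling _≺_
      open PullingProperties sto
      open IsStrictTotalOrder sto using (compare; irrefl)

      -- The pulling triangulation of a square face {i , k} × {j , l} uses the diagonal through
      -- its least vertex, so a diagonal x , y is an edge unless a corner lies below x and y.
      NoLowCorner : Sub V → Set
      NoLowCorner S = ∀ x y → x ∈ S → y ∈ S → ∀ c → tl c ≡ tl x → hd c ≡ hd y → ¬ (c ≺ x × c ≺ y)

      noLowCorner-delete : ∀ {v S} → NoLowCorner S → NoLowCorner (delete v S)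
      noLowCorner-delete {S = S} noLow x y x∈ y∈ = noLow x y (proj₁ (∈delete⁻ S x∈)) (proj₁ (∈delete⁻ S y∈))

      corner-vertex : ∀ {𝒫 σ} → (∀ {G} → 𝒫 G → Face G) → Pull 𝒫 σ →
                      ∀ x y c → x ∈ σ → y ∈ σ → tl c ≡ tl x → hd c ≡ hd y → IsVertex 𝒫 c
      corner-vertex faces p x y c x∈σ y∈σ tc≡tx hc≡hy with pull⇒withinFace p
      ... | M , M∈𝒫 , σ⊆M = M , M∈𝒫 , face-cornerClosed (faces M∈𝒫) x y c (σ⊆M x x∈σ) (σ⊆M y y∈σ) tc≡tx hc≡hy

      pull⇒noLowCorner : ∀ {𝒫 σ} → (∀ {G} → 𝒫 G → Face G) → Pull 𝒫 σ → NoLowCorner σ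
      pull⇒noLowCorner {σ = σ} faces p@(base amo σ∈𝒫) x y x∈σ y∈σ c tc≡tx hc≡hy (c≺x , _) =
        irrefl (amo c x (corner-vertex faces p x y c x∈σ y∈σ tc≡tx hc≡hy) (σ , σ∈𝒫 , x∈σ)) c≺x
      pull⇒noLowCorner faces (rest _ _ p) = pull⇒noLowCorner (faces ∘ proj₁) p
      pull⇒noLowCorner faces p@(cone {G = G} _ least _ _ _ _ q) x y x∈σ y∈σ c tc≡tx hc≡hy (c≺x , c≺y)
        with ∈insert⁻ G x∈σ | ∈insert⁻ G y∈σ
      ... | inj₁ refl | _ = ¬≺least least (corner-vertex faces p x y c x∈σ y∈σ tc≡tx hc≡hy) c≺x
      ... | _ | inj₁ refl = ¬≺least least (corner-vertex faces p x y c x∈σ y∈σ tc≡tx hc≡hy) c≺y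
      ... | inj₂ x∈G | inj₂ y∈G = pull⇒noLowCorner (faces ∘ proj₁) q x y x∈G y∈G c tc≡tx hc≡hy (c≺x , c≺y)

      least-vertex : ∀ {𝒫 W L} → Models 𝒫 W → (∀ z → z ∈ W → z ∈ˡ L) →
                     (∃ λ v → Least 𝒫 v) ⊎ (∀ z → ¬ IsVertex 𝒫 z)
      least-vertex {𝒫} {W} {L} 𝒫≈W W⊆L with minimal-in sto (λ z → T? (W z)) L
      ... | inj₂ none = inj₂ λ z z-vertex → let z∈W = vertex⇒allowed 𝒫≈W z-vertex in none (W⊆L z z∈W) z∈W
      ... | inj₁ (v , v∈W , minimal) = inj₁ (v , allowed⇒vertex 𝒫≈W v∈W , above)
        where
        above : ∀ w → IsVertex 𝒫 w → w ≢ v → v ≺ w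
        above w w-vertex w≢v with compare v w
        ... | tri< v≺w _ _ = v≺w
        ... | tri≈ _ v≡w _ = ⊥-elim (w≢v (sym v≡w))
        ... | tri> _ _ w≺v = ⊥-elim (minimal (W⊆L w w∈W) w∈W w≺v)
          where
          w∈W = vertex⇒allowed 𝒫≈W w-vertex

      rowFree⊎columnFree : ∀ {𝒫 v S} → Least 𝒫 v → WithinFace 𝒫 S → NoLowCorner S →
                           RowFree v S ⊎ ColumnFree v S
      rowFree⊎columnFree {v = v} {S} (_ , least) (M , M∈𝒫 , S⊆M) noLow
        with any-vertex? (λ x → T? (S x) ×-dec ¬? (x ≟ᴸ v) ×-dec (tl x ≟ᶠ tl v))
      ... | no ∄x = inj₁ λ x x∈S x≢v tx≡tv → ∄x (x , x∈S , x≢v , tx≡tv)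
      ... | yes (x , x∈S , x≢v , tx≡tv) = inj₂ λ y y∈S y≢v hy≡hv →
        noLow x y x∈S y∈S v (sym tx≡tv) (sym hy≡hv) (above x x∈S x≢v , above y y∈S y≢v)
        where
        above : ∀ z → z ∈ S → z ≢ v → v ≺ z
        above z z∈S z≢v = least z (M , M∈𝒫 , S⊆M z z∈S) z≢v

      withinFace-─ : ∀ {𝒫 W v S} → Models 𝒫 W → Least 𝒫 v → v ∉ S → WithinFace 𝒫 S → NoLowCorner S →
                     WithinFace (𝒫 ─ v) S
      withinFace-─ {v = v} {S} 𝒫≈W least v∉S S-within noLow = span S , (span∈ 𝒫≈W S-within , v∉span) , ⊆span S
        where
        v∉span : v ∉ span S
        v∉span v∈span with ∈select⁻ (has-tail? S) (proj₁ (∈prod⁻ {x = v} v∈span))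
                         | ∈select⁻ (has-head? S) (proj₂ (∈prod⁻ {x = v} v∈span))
                         | rowFree⊎columnFree least S-within noLow
        ... | x , x∈S , tx≡tv | _ | inj₁ rowFree = rowFree x x∈S (λ { refl → v∉S x∈S }) tx≡tv
        ... | _ | y , y∈S , hy≡hv | inj₂ columnFree = columnFree y y∈S (λ { refl → v∉S y∈S }) hy≡hv

      ConeData : Complex → V → Sub V → Set
      ConeData 𝒫 v S = ∃ λ M → MaximalFace 𝒫 M × v ∈ M × AvoidingFacet 𝒫 M v S

      cone-data : ∀ {𝒫 W v S} → Models 𝒫 W → Least 𝒫 v → v ∈ S → WithinFace 𝒫 S → NoLowCorner S →
                  ConeData 𝒫 v S
      cone-data {𝒫} {v = v} {S} 𝒫≈W least v∈S S-within noLow =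
        around (maximal-face {v = v} 𝒫≈W (span-admissible 𝒫≈W S-within) (⊆span S v v∈S))
        where
        around : (∃ λ I → ∃ λ J → Disjoint I J × span S ⊆ prod I J × MaximalFace 𝒫 (prod I J)) →
                 ConeData 𝒫 v S
        around (I , J , disj , span⊆M , max@(M∈𝒫 , _)) =
          prod I J , max , v∈M
                   , Facets.avoiding-facet 𝒫≈W disj M∈𝒫 v∈M S⊆M (rowFree⊎columnFree least S-within noLow)
          where
          S⊆M : S ⊆ prod I J
          S⊆M x x∈S = span⊆M x (⊆span S x x∈S)
          v∈M : v ∈ prod I J
          v∈M = S⊆M v v∈S

      simplex-≤1-vertex : ∀ {𝒫 W S} → Models 𝒫 W → AtMostOneVertex 𝒫 → WithinFace 𝒫 S → IsSimplex 𝒫 S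
      simplex-≤1-vertex {S = S} 𝒫≈W amo S-within = span S , base amo span∈𝒫 , span⊆S , ⊆span S
        where
        span∈𝒫 = span∈ 𝒫≈W S-within
        span⊆S : span S ⊆ S
        span⊆S x x∈ with ∈select⁻ (has-tail? S) (proj₁ (∈prod⁻ {x = x} x∈))
        ... | y , y∈S , _ =
          subst (_∈ S) (amo y x (span S , span∈𝒫 , ⊆span S y y∈S) (span S , span∈𝒫 , x∈)) y∈S

      CompleteFor : List V → Set₁
      CompleteFor L = ∀ {𝒫 W} → Models 𝒫 W → (∀ z → z ∈ W → z ∈ˡ L) →
                      ∀ {S} → WithinFace 𝒫 S → NoLowCorner S → IsSimplex 𝒫 S

      simplex-step : ∀ {𝒫 W L v} → Models 𝒫 W → (∀ z → z ∈ W → z ∈ˡ L) → Least 𝒫 v → ¬ AtMostOneVertex 𝒫 →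
                     CompleteFor (without v L) → ∀ {S} → WithinFace 𝒫 S → NoLowCorner S → IsSimplex 𝒫 S
      simplex-step {𝒫} {L = L} {v} 𝒫≈W W⊆L least many complete′ {S} S-within noLow with T? (S v)
      ... | no v∉S = simplex-rest many least
        (complete′ (models-─ 𝒫≈W) (delete⊆without W⊆L) (withinFace-─ 𝒫≈W least v∉S S-within noLow) noLow)
      ... | yes v∈S = cone-step (cone-data 𝒫≈W least v∈S S-within noLow)
        where
        cone-step : ConeData 𝒫 v S → IsSimplex 𝒫 S
        cone-step (_ , max , v∈M , F , facet@(F∈𝒫 , _) , v∉F , S⁻⊆F) =
          simplex-cone many least max v∈M facet v∉F v∈S
            (complete′ (models-⟨⟩ 𝒫≈W F∈𝒫) F⊆L′ (F , (F∈𝒫 , λ _ → id) , S⁻⊆F) (noLowCorner-delete noLow))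
          where
          F⊆L′ : ∀ z → z ∈ F → z ∈ˡ without v L
          F⊆L′ z z∈F = ∈without (W⊆L z (allowed 𝒫≈W F∈𝒫 z z∈F)) λ { refl → v∉F z∈F }

      complete : ∀ L → Acc _<ℕ_ (length L) → CompleteFor L
      complete L (acc shorter) {𝒫} {W} 𝒫≈W W⊆L S-within noLow with least-vertex 𝒫≈W W⊆L
      ... | inj₂ no-vertex = simplex-≤1-vertex 𝒫≈W (λ x _ x-vertex _ → ⊥-elim (no-vertex x x-vertex)) S-within
      ... | inj₁ (v , least) with any-vertex? (λ w → T? (W w) ×-dec ¬? (w ≟ᴸ v))
      ...   | no ∄w = simplex-≤1-vertex 𝒫≈W only-v S-within
        where
        is-v : ∀ x → IsVertex 𝒫 x → x ≡ v
        is-v x x-vertex with x ≟ᴸ v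
        ... | yes x≡v = x≡v
        ... | no x≢v = ⊥-elim (∄w (x , vertex⇒allowed 𝒫≈W x-vertex , x≢v))
        only-v : AtMostOneVertex 𝒫
        only-v x y x-vertex y-vertex = trans (is-v x x-vertex) (sym (is-v y y-vertex))
      ...   | yes (w , w∈W , w≢v) =
        simplex-step 𝒫≈W W⊆L least many (complete (without v L) (shorter fewer)) S-within noLow
        where
        fewer : length (without v L) <ℕ length L
        fewer = without-shorter (W⊆L v (vertex⇒allowed 𝒫≈W (proj₁ least)))
        many : ¬ AtMostOneVertex 𝒫
        many amo = w≢v (amo w v (allowed⇒vertex 𝒫≈W w∈W) (proj₁ least))

      flag : IsFlagPulling Face
      flag S pairs = complete allV (<-wellFounded _) models-boundary (λ z _ → ∈allV z)
                       (span S , span-face bipartite , ⊆span S) noLow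
        where
        bipartite : Bipartite S
        bipartite x y x∈S y∈S with pair-simplex (pairs x y x∈S y∈S)
        ... | σ , p , x∈σ , y∈σ = within-bipartite models-boundary (pull⇒withinFace p) x y x∈σ y∈σ
        noLow : NoLowCorner S
        noLow x y x∈S y∈S with pair-simplex (pairs x y x∈S y∈S)
        ... | σ , p , x∈σ , y∈σ = pull⇒noLowCorner id p x y x∈σ y∈σ

theorem3p1 : (n : ℕ) → 1 ≤ n → (_<_ : Rel (LVertex n) 0ℓ) →
    IsStrictTotalOrder _≡_ _<_ →
    Complexes.Pulling.IsFlagPulling (_≟ᴸ_ {n}) _<_ (boundaryLegendre n)
theorem3p1 n n≥1 _<_ sto = Legendre.Pulled.flag n n≥1 sto
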